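{- Let $\mathcal{A}$ be an axiom system (a set of formulas containing $(\mathrm{Ax}_{=1})$) and let $d\in D$. The following are equivalent: (i) $d\models\sigma^{\mathcal{A}}$; (ii) for every $\mathcal{A}$-p-knowledge set $K$ we have $d\in K$ and $d\neq\max K$; (iii) $d\in K_{\mathcal{A}}$ and $d\neq\max K_{\mathcal{A}}$; (iv) $d\in D^{\mathcal{A}}_{\mathrm{surpr}}$.
   Context: Let $R=\{\mathrm{Mo},\mathrm{Tu},\mathrm{We},\mathrm{Th},\mathrm{Fr},\mathrm{none}\}$ be linearly ordered by $\mathrm{Mo}<\mathrm{Tu}<\mathrm{We}<\mathrm{Th}<\mathrm{Fr}<\mathrm{none}$, and let $D=\{\mathrm{Mo},\dots,\mathrm{Fr}\}$ (the days). Propositional formulas are built from six atoms $Y_r$ ($r\in R$) using $\bot$ and $\to$ (with the usual derived connectives, $\top:=\neg\bot$). The axiom $(\mathrm{Ax}_{=1})$ is the formula $\bigvee_{r\in R}Y_r\wedge\bigwedge_{r<s}(\neg Y_r\vee\neg Y_s)$, expressing that exactly one $Y_r$ is true. The models satisfying $(\mathrm{Ax}_{=1})$ are the six assignments making exactly one atom true; these are identified with the elements of $R$ ($r$ makes $Y_r$ true), and $r\models\varphi$ means $\varphi$ is true under that assignment. An axiom system $\mathcal{A}$ is a set of formulas always containing $(\mathrm{Ax}_{=1})$; $\mathcal{A}\vdash\varphi$ denotes propositional provability (equivalently: $\varphi$ holds in every $r\in R$ satisfying all formulas of $\mathcal{A}$). For $B\subseteq R$ write $\langle T\in B\rangle:=\bigvee_{r\in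 B}Y_r$, $\langle T\le d\rangle:=\langle T\in\{r\in R: r\le d\}\rangle$, $\langle T=r\rangle:=Y_r$, $\langle T\neq r\rangle:=\neg Y_r$. A set $K\subseteq R$ is an $\mathcal{A}$-p-knowledge set if $\mathcal{A}\vdash\langle T\in K\rangle$; $K_{\mathcal{A}}$ is the intersection of all $\mathcal{A}$-p-knowledge sets (itself the smallest $\mathcal{A}$-p-knowledge set). A day $d\in D$ is $\mathcal{A}$-p-surprising if $d\in K_{\mathcal{A}}$ and $\mathcal{A}\nvdash\langle T\le d\rangle$; $D^{\mathcal{A}}_{\mathrm{surpr}}$ is the set of $\mathcal{A}$-p-surprising days. Iverson brackets: for an assertion $S$, $[S]$ is the formula $\top$ if $S$ is true and $\bot$ if $S$ is false. Define $\sigma^{\mathcal{A}}:=\bigwedge_{K\subseteq R}\bigl([K_{\mathcal{A}}\subseteq K]\to\langle T\in K-\{\max K\}\rangle\bigr)$, with the convention $\emptyset-\{\max\emptyset\}=\emptyset$. -}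

module Defs where

open import Level using (0ℓ)
open import Data.Bool using (Bool; true; false; if_then_else_; not; _∧_)
open import Data.Nat using (ℕ; zero; suc)
open import Data.Fin using (Fin; zero; suc; _<_; _≤_; _≟_; _≤?_)
open import Data.Fin.Subset using (Subset; _∈_; _⊆_; _-_; ⁅_⁆)
open import Data.Fin.Subset.Properties using (_∈?_; _⊆?_)
open import Data.Vec using (Vec; []; _∷_; tabulate)
open import Data.List as L using (List; []; _∷_; filter; map; foldr; allFin; last; concatMap)
open import Data.Maybe using (Maybe; just; nothing)
open import Data.Product using (_×_)
open import Relation.Nullary using (Dec; does; ¬_)
open import Relation.Binary.PropositionalEquality using (_≡_; _≢_)
open import Axiom.ExcludedMiddle using (ExcludedMiddle)

-- R = {Mo < Tu < We < Th < Fr < none}, encoded as Fin 6 with its usual order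

R : Set
R = Fin 6

pattern Mo   = zero
pattern Tu   = suc zero
pattern We   = suc (suc zero)
pattern Th   = suc (suc (suc zero))
pattern Fr   = suc (suc (suc (suc zero)))
pattern none = suc (suc (suc (suc (suc zero))))

SubR : Set
SubR = Subset 6

D : SubR
D = true ∷ true ∷ true ∷ true ∷ true ∷ false ∷ []

infixr 4 _⇒_
data Formula : Set where
  Y   : R → Formula
  ⊥'  : Formula
  _⇒_ : Formula → Formula → Formula

¬' : Formula → Formula
¬' φ = φ ⇒ ⊥'

⊤' : Formula
⊤' = ¬' ⊥'

_∨'_ : Formula → Formula → Formula
φ ∨' ψ = ¬' φ ⇒ ψ

_∧'_ : Formula → Formula → Formula
φ ∧' ψ = ¬' (φ ⇒ ¬' ψ)

⋁ : List Formula → Formula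
⋁ = foldr _∨'_ ⊥'

⋀ : List Formula → Formula
⋀ = foldr _∧'_ ⊤'

Valuation : Set
Valuation = R → Bool

eval : Valuation → Formula → Bool
eval v (Y r)   = v r
eval v ⊥'      = false
eval v (φ ⇒ ψ) = if eval v φ then eval v ψ else true

pt : R → Valuation
pt r s = does (s ≟ r)

_⊨_ : R → Formula → Set
r ⊨ φ = eval (pt r) φ ≡ true

pairsLt : List (R × R)
pairsLt = concatMap (λ r → map (λ s → (r Data.Product., s)) (filter (λ s → r <? s) (allFin 6))) (allFin 6)
  where
    open import Data.Fin using (_<?_)

Ax₌₁ : Formula
Ax₌₁ = ⋁ (map Y (allFin 6))
     ∧' ⋀ (map (λ p → ¬' (Y (Data.Product.proj₁ p)) ∨' ¬' (Y (Data.Product.proj₂ p))) pairsLt)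

-- Provability is propositional consequence (by soundness/completeness
-- of propositional logic): true under every valuation satisfying 𝒜.

AxiomSystem : Set₁
AxiomSystem = Formula → Set

_⊢_ : AxiomSystem → Formula → Set
𝒜 ⊢ φ = (v : Valuation) → (∀ ψ → 𝒜 ψ → eval v ψ ≡ true) → eval v φ ≡ true

members : SubR → List R
members B = filter (_∈? B) (allFin 6)

⟨T∈_⟩ : SubR → Formula
⟨T∈ B ⟩ = ⋁ (map Y (members B))

downSet : R → SubR
downSet d = tabulate (λ r → does (r ≤? d))

⟨T≤_⟩ : R → Formula
⟨T≤ d ⟩ = ⟨T∈ downSet d ⟩

IsKnowledgeSet : AxiomSystem → SubR → Set
IsKnowledgeSet 𝒜 K = 𝒜 ⊢ ⟨T∈ K ⟩

-- Membership in it is a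
-- classical (in general undecidable) statement; excluded middle is used
-- to turn it into a concrete subset of R (as in the paper's classical
-- metatheory).
K[_] : ExcludedMiddle 0ℓ → AxiomSystem → SubR
K[ em ] 𝒜 = tabulate (λ r → does (em {∀ K → IsKnowledgeSet 𝒜 K → r ∈ K}))

maxS : SubR → Maybe R
maxS K = last (members K)

-- K − {max K}, with ∅ − {max ∅} = ∅
removeMax : SubR → SubR
removeMax K with maxS K
... | just m  = K - m
... | nothing = K

IsSurprising : ExcludedMiddle 0ℓ → AxiomSystem → R → Set
IsSurprising em 𝒜 d = d ∈ D × d ∈ K[ em ] 𝒜 × ¬ (𝒜 ⊢ ⟨T≤ d ⟩)

[_] : {P : Set} → Dec P → Formula
[ p ] = if does p then ⊤' else ⊥'

allSubsets : (n : ℕ) → List (Subset n)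
allSubsets zero    = [] ∷ []
allSubsets (suc n) = concatMap (λ s → (true ∷ s) ∷ (false ∷ s) ∷ []) (allSubsets n)

σ[_] : ExcludedMiddle 0ℓ → AxiomSystem → Formula
σ[ em ] 𝒜 = ⋀ (map (λ K → [ K[ em ] 𝒜 ⊆? K ] ⇒ ⟨T∈ removeMax K ⟩) (allSubsets 6))

{-# OPTIONS --safe #-}
-- Every valuation satisfying Ax₌₁ is one of the six points r ∈ R, so 𝒜 ⊢ ⟨T ∈ K⟩ holds
-- exactly when every model r of 𝒜 lies in K: K_𝒜 is the set of models of 𝒜, and the
-- knowledge sets are precisely the supersets of K_𝒜.  For d ∈ K, "d ≠ max K" means
-- K ⊈ {r ≤ d}, which is inherited by supersets; so it holds for all knowledge sets iff it
-- holds for K_𝒜, where it says 𝒜 ⊬ ⟨T ≤ d⟩.  And d ⊨ σ^𝒜 unfolds to "d ∈ K − {max K} for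
-- every K ⊇ K_𝒜".
module Submission where

open import Defs
open import Level using (0ℓ)
open import Axiom.ExcludedMiddle using (ExcludedMiddle)
open import Data.Bool using (Bool; true; false)
import Data.Bool.Properties as Bool
open import Data.Fin using (Fin; _≟_)
open import Data.Fin.Properties using (all?; any?)
open import Data.Fin.Subset using (Subset; _∈_; _⊆_)
open import Data.Fin.Subset.Properties using (_∈?_; _⊆?_; anySubset?; ⊆-refl)
open import Data.List using ([]; _∷_; map)
open import Data.List.Membership.Propositional using () renaming (_∈_ to _∈ₗ_)
open import Data.List.Membership.Propositional.Properties using (∈-concatMap⁺)
open import Data.List.Relation.Unary.All as All using (All; []; _∷_)
import Data.List.Relation.Unary.All.Properties as All
import Data.List.Relation.Unary.Any as Any
open import Data.Maybe using (just)
open import Data.Maybe.Properties using (≡-dec)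
open import Data.Product using (_×_; _,_; proj₂; ∃)
open import Data.Vec using ([]; _∷_; lookup; tabulate)
open import Data.Vec.Properties using (lookup∘tabulate; []=⇒lookup; lookup⇒[]=)
open import Function using (_∘_)
open import Function.Bundles using (_⇔_; mk⇔; Equivalence)
import Function.Properties.Equivalence as ⇔
open import Relation.Binary.PropositionalEquality using (_≡_; _≢_; _≗_; refl; sym; trans)
open import Relation.Nullary using (Dec; yes; no; does; ¬_; contradiction)
open import Relation.Nullary.Decidable using (_×-dec_; _→-dec_; ¬?; map′; from-yes; decidable-stable)
open import Relation.Unary using (Pred; Decidable)

open Equivalence using (to; from)

_⇔?_ : {A B : Set} → Dec A → Dec B → Dec (A ⇔ B)
a? ⇔? b? = map′ (λ (f , g) → mk⇔ f g) (λ e → to e , from e) ((a? →-dec b?) ×-dec (b? →-dec a?))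

allSubset? : ∀ {n ℓ} {P : Pred (Subset n) ℓ} → Decidable P → Dec (∀ K → P K)
allSubset? P? = map′ (λ noCounterexample K → decidable-stable (P? K) (noCounterexample ∘ (K ,_)))
                     (λ ∀P (K , ¬PK) → ¬PK (∀P K))
                     (¬? (anySubset? (¬? ∘ P?)))

does≡true⇔ : {A : Set} (a? : Dec A) → does a? ≡ true ⇔ A
does≡true⇔ (yes a) = mk⇔ (λ _ → a) (λ _ → refl)
does≡true⇔ (no ¬a) = mk⇔ (λ ()) (λ a → contradiction a ¬a)

∈-tabulate⇔ : ∀ {n} (f : Fin n → Bool) r → r ∈ tabulate f ⇔ f r ≡ true
∈-tabulate⇔ f r = mk⇔ (λ r∈ → trans (sym (lookup∘tabulate f r)) ([]=⇒lookup r∈))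
                      (λ fr → lookup⇒[]= r _ (trans (lookup∘tabulate f r) fr))

∈-allSubsets : ∀ {n} (K : Subset n) → K ∈ₗ allSubsets n
∈-allSubsets []          = Any.here refl
∈-allSubsets (true ∷ K)  = ∈-concatMap⁺ _ (Any.map (λ { refl → Any.here refl }) (∈-allSubsets K))
∈-allSubsets (false ∷ K) = ∈-concatMap⁺ _ (Any.map (λ { refl → Any.there (Any.here refl) }) (∈-allSubsets K))

All-allSubsets⇔ : ∀ {n ℓ} {P : Pred (Subset n) ℓ} → All P (allSubsets n) ⇔ (∀ K → P K)
All-allSubsets⇔ = mk⇔ (λ all K → All.lookup all (∈-allSubsets K)) (λ ∀P → All.tabulate (λ {K} _ → ∀P K))

⊨⟨T∈⟩⇔∈ : ∀ B r → r ⊨ ⟨T∈ B ⟩ ⇔ r ∈ B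
⊨⟨T∈⟩⇔∈ = from-yes (allSubset? λ B → all? λ r → (eval (pt r) ⟨T∈ B ⟩ Bool.≟ true) ⇔? (r ∈? B))

maxS≡just⇔ : ∀ K m → maxS K ≡ just m ⇔ (m ∈ K × K ⊆ downSet m)
maxS≡just⇔ = from-yes (allSubset? λ K → all? λ m →
  ≡-dec _≟_ (maxS K) (just m) ⇔? ((m ∈? K) ×-dec (K ⊆? downSet m)))

∈-removeMax⇔ : ∀ K d → d ∈ removeMax K ⇔ (d ∈ K × maxS K ≢ just d)
∈-removeMax⇔ = from-yes (allSubset? λ K → all? λ d →
  (d ∈? removeMax K) ⇔? ((d ∈? K) ×-dec ¬? (≡-dec _≟_ (maxS K) (just d))))

eval-cong : ∀ {v w} → v ≗ w → ∀ φ → eval v φ ≡ eval w φ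
eval-cong v≗w (Y r)   = v≗w r
eval-cong v≗w ⊥'      = refl
eval-cong v≗w (φ ⇒ ψ) rewrite eval-cong v≗w φ | eval-cong v≗w ψ = refl

eval-∧' : ∀ v φ ψ → eval v (φ ∧' ψ) ≡ true ⇔ (eval v φ ≡ true × eval v ψ ≡ true)
eval-∧' v φ ψ with eval v φ | eval v ψ
... | true  | true  = mk⇔ (λ _ → refl , refl) (λ _ → refl)
... | true  | false = mk⇔ (λ ()) (λ ())
... | false | _     = mk⇔ (λ ()) (λ ())

eval-⋀-map : ∀ {A : Set} v (f : A → Formula) xs →
             eval v (⋀ (map f xs)) ≡ true ⇔ All (λ x → eval v (f x) ≡ true) xs
eval-⋀-map v f []       = mk⇔ (λ _ → []) (λ _ → refl)
eval-⋀-map v f (x ∷ xs) = mk⇔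
  (λ h → let v⊨fx , v⊨fxs = to (eval-∧' v (f x) (⋀ (map f xs))) h
         in v⊨fx ∷ to (eval-⋀-map v f xs) v⊨fxs)
  (λ { (v⊨fx ∷ v⊨fxs) → from (eval-∧' v (f x) (⋀ (map f xs))) (v⊨fx , from (eval-⋀-map v f xs) v⊨fxs) })

eval-[]⇒ : ∀ {P : Set} v (p : Dec P) φ → eval v ([ p ] ⇒ φ) ≡ true ⇔ (P → eval v φ ≡ true)
eval-[]⇒ v (yes p) φ = mk⇔ (λ v⊨φ _ → v⊨φ) (λ v⊨φ → v⊨φ p)
eval-[]⇒ v (no ¬p) φ = mk⇔ (λ _ p → contradiction p ¬p) (λ _ → refl)

Ax₌₁⇒≗pt : ∀ v → eval v Ax₌₁ ≡ true → ∃ λ s → v ≗ pt s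
Ax₌₁⇒≗pt v v⊨Ax =
  let s , table≗s = onTables (tabulate v) (trans (sym (eval-cong v≗table Ax₌₁)) v⊨Ax)
  in s , λ r → trans (v≗table r) (table≗s r)
  where
    v≗table : v ≗ lookup (tabulate v)
    v≗table = sym ∘ lookup∘tabulate v

    onTables : ∀ (u : Subset 6) → eval (lookup u) Ax₌₁ ≡ true → ∃ λ s → lookup u ≗ pt s
    onTables = from-yes (allSubset? λ u → (eval (lookup u) Ax₌₁ Bool.≟ true) →-dec
                                           any? λ s → all? λ r → lookup u r Bool.≟ pt s r)

Satisfies : Valuation → AxiomSystem → Set
Satisfies v 𝒜 = ∀ ψ → 𝒜 ψ → eval v ψ ≡ true

Satisfies-cong : ∀ {v w 𝒜} → v ≗ w → Satisfies v 𝒜 → Satisfies w 𝒜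
Satisfies-cong v≗w v⊨𝒜 ψ 𝒜ψ = trans (sym (eval-cong v≗w ψ)) (v⊨𝒜 ψ 𝒜ψ)

NonMaximalIn : SubR → R → Set
NonMaximalIn K d = d ∈ K × maxS K ≢ just d

maxS≢⇔⊈downSet : ∀ {K d} → d ∈ K → maxS K ≢ just d ⇔ (¬ K ⊆ downSet d)
maxS≢⇔⊈downSet {K} {d} d∈K = mk⇔
  (λ max≢d (K⊆↓d : K ⊆ downSet d) → max≢d (from (maxS≡just⇔ K d) (d∈K , K⊆↓d)))
  (λ K⊈↓d max≡d → K⊈↓d (proj₂ (to (maxS≡just⇔ K d) max≡d)))

NonMaximalIn-mono : ∀ {K L d} → K ⊆ L → NonMaximalIn K d → NonMaximalIn L d
NonMaximalIn-mono K⊆L (d∈K , maxK≢d) = K⊆L d∈K , from (maxS≢⇔⊈downSet (K⊆L d∈K))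
  (λ L⊆↓d → to (maxS≢⇔⊈downSet d∈K) maxK≢d (λ x∈K → L⊆↓d (K⊆L x∈K)))

module _ (em : ExcludedMiddle 0ℓ) (𝒜 : AxiomSystem) where

  ∈K[]⇔ : ∀ r → r ∈ K[ em ] 𝒜 ⇔ (∀ K → IsKnowledgeSet 𝒜 K → r ∈ K)
  ∈K[]⇔ r = ⇔.trans (∈-tabulate⇔ (λ r → does (em {∀ K → IsKnowledgeSet 𝒜 K → r ∈ K})) r)
                    (does≡true⇔ em)

  model∈K[] : ∀ s → Satisfies (pt s) 𝒜 → s ∈ K[ em ] 𝒜
  model∈K[] s s⊨𝒜 = from (∈K[]⇔ s) (λ K 𝒜⊢K → to (⊨⟨T∈⟩⇔∈ K s) (𝒜⊢K (pt s) s⊨𝒜))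

  IsKnowledgeSet⇔K[]⊆ : 𝒜 Ax₌₁ → ∀ K → IsKnowledgeSet 𝒜 K ⇔ K[ em ] 𝒜 ⊆ K
  IsKnowledgeSet⇔K[]⊆ ax K = mk⇔ knowledge⇒superset superset⇒knowledge
    where
      knowledge⇒superset : IsKnowledgeSet 𝒜 K → K[ em ] 𝒜 ⊆ K
      knowledge⇒superset 𝒜⊢K r∈K𝒜 = to (∈K[]⇔ _) r∈K𝒜 K 𝒜⊢K

      superset⇒knowledge : K[ em ] 𝒜 ⊆ K → IsKnowledgeSet 𝒜 K
      superset⇒knowledge K𝒜⊆K v v⊨𝒜 =
        let s , v≗s = Ax₌₁⇒≗pt v (v⊨𝒜 Ax₌₁ ax)
            s∈K = K𝒜⊆K (model∈K[] s (Satisfies-cong v≗s v⊨𝒜))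
        in trans (eval-cong v≗s ⟨T∈ K ⟩) (from (⊨⟨T∈⟩⇔∈ K s) s∈K)

  ⊨σ⇔ : ∀ d → d ⊨ σ[ em ] 𝒜 ⇔ (∀ K → K[ em ] 𝒜 ⊆ K → d ∈ removeMax K)
  ⊨σ⇔ d = mk⇔
    (λ d⊨σ K → to (clause⇔ K) (to All-allSubsets⇔ (to ⊨⋀clauses⇔ d⊨σ) K))
    (λ h → from ⊨⋀clauses⇔ (from All-allSubsets⇔ (λ K → from (clause⇔ K) (h K))))
    where
      clause : SubR → Formula
      clause K = [ K[ em ] 𝒜 ⊆? K ] ⇒ ⟨T∈ removeMax K ⟩

      ⊨⋀clauses⇔ : d ⊨ σ[ em ] 𝒜 ⇔ All (λ K → d ⊨ clause K) (allSubsets 6)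
      ⊨⋀clauses⇔ = eval-⋀-map (pt d) clause (allSubsets 6)

      clause⇔ : ∀ K → d ⊨ clause K ⇔ (K[ em ] 𝒜 ⊆ K → d ∈ removeMax K)
      clause⇔ K = ⇔.trans (eval-[]⇒ (pt d) (K[ em ] 𝒜 ⊆? K) ⟨T∈ removeMax K ⟩)
        (mk⇔ (λ h K𝒜⊆K → to (⊨⟨T∈⟩⇔∈ (removeMax K) d) (h K𝒜⊆K))
             (λ h K𝒜⊆K → from (⊨⟨T∈⟩⇔∈ (removeMax K) d) (h K𝒜⊆K)))

lemma3p7 : (em : ExcludedMiddle 0ℓ) (𝒜 : AxiomSystem) → 𝒜 Ax₌₁ → (d : R) → d ∈ D →
    ((d ⊨ σ[ em ] 𝒜) ⇔ (∀ K → IsKnowledgeSet 𝒜 K → d ∈ K × maxS K ≢ just d))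
    × ((∀ K → IsKnowledgeSet 𝒜 K → d ∈ K × maxS K ≢ just d) ⇔ (d ∈ K[ em ] 𝒜 × maxS (K[ em ] 𝒜) ≢ just d))
    × ((d ∈ K[ em ] 𝒜 × maxS (K[ em ] 𝒜) ≢ just d) ⇔ IsSurprising em 𝒜 d)
lemma3p7 em 𝒜 ax d d∈D = i⇔ii , ii⇔iii , iii⇔iv
  where
    K𝒜 : SubR
    K𝒜 = K[ em ] 𝒜

    knowledge⇔ : ∀ K → IsKnowledgeSet 𝒜 K ⇔ K𝒜 ⊆ K
    knowledge⇔ = IsKnowledgeSet⇔K[]⊆ em 𝒜 ax

    i⇔ii : d ⊨ σ[ em ] 𝒜 ⇔ (∀ K → IsKnowledgeSet 𝒜 K → NonMaximalIn K d)
    i⇔ii = mk⇔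
      (λ d⊨σ K 𝒜⊢K → to (∈-removeMax⇔ K d) (to (⊨σ⇔ em 𝒜 d) d⊨σ K (to (knowledge⇔ K) 𝒜⊢K)))
      (λ ii → from (⊨σ⇔ em 𝒜 d) λ K K𝒜⊆K → from (∈-removeMax⇔ K d) (ii K (from (knowledge⇔ K) K𝒜⊆K)))

    ii⇔iii : (∀ K → IsKnowledgeSet 𝒜 K → NonMaximalIn K d) ⇔ NonMaximalIn K𝒜 d
    ii⇔iii = mk⇔ (λ ii → ii K𝒜 (from (knowledge⇔ K𝒜) ⊆-refl))
                 (λ iii K 𝒜⊢K → NonMaximalIn-mono (to (knowledge⇔ K) 𝒜⊢K) iii)

    iii⇔iv : NonMaximalIn K𝒜 d ⇔ IsSurprising em 𝒜 d
    iii⇔iv = mk⇔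
      (λ (d∈K𝒜 , max≢d) → d∈D , d∈K𝒜 ,
         λ 𝒜⊢≤d → to (maxS≢⇔⊈downSet d∈K𝒜) max≢d (to (knowledge⇔ (downSet d)) 𝒜⊢≤d))
      (λ (_ , d∈K𝒜 , 𝒜⊬≤d) → d∈K𝒜 ,
         from (maxS≢⇔⊈downSet d∈K𝒜) (λ K𝒜⊆↓d → 𝒜⊬≤d (from (knowledge⇔ (downSet d)) K𝒜⊆↓d)))
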